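{- Let $k\geq1$ and let $\pi:G\to H$ be a homomorphism of finite abelian groups (written additively). Let $X=\{g\in G:\operatorname{ord}(g)\nmid k \text{ and } \operatorname{ord}(\pi(g))\mid k\}$. (a) $X\neq\emptyset$ if and only if $\ker\pi\cap kG\neq\{0\}$. (b) Suppose $\ell$ is a prime such that $\ker\pi$ is an $\ell$-group. Let $G'$, $H'$ be the Sylow $\ell$-subgroups of $G$, $H$, let $\pi':G'\to H'$ be the restriction of $\pi$, let $X'=\{s\in G':\operatorname{ord}(s)\nmid k\text{ and }\operatorname{ord}(\pi'(s))\mid k\}$, and let $r=\nu_\ell(k)$. Then $X\neq\emptyset \iff X'\neq\emptyset\iff \ker\pi'\cap \ell^rG'\neq\{0\}$. (c) Let $\ell$ be a prime, $r=\nu_\ell(k)$, and let $f:G\to H$ be a surjective homomorphism of finite abelian $\ell$-groups such that $\ker f$ is cyclic of order $\ell$. With $X=\{g\in G:\operatorname{ord}(g)\nmid k\text{ and }\operatorname{ord}(f(g))\mid k\}$, we have $X\neq\emptyset$ if and only if $|G/\ell^rG|=|H/\ell^rH|$.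
   Context: $\nu_\ell(k)$ denotes the $\ell$-adic valuation of the integer $k$. -}

module Defs where

open import Data.Nat using (ℕ; zero; suc; _<_; _≤_; _^_)
open import Data.Nat.Divisibility using (_∣_)
open import Data.Fin using (Fin; toℕ)
open import Data.Fin.Properties using (_≟_; any?; all?)
import Data.Nat.Properties as ℕP
open import Data.List using (List; length; filter; allFin)
open import Data.Product using (Σ; ∃; _×_; _,_)
open import Relation.Nullary using (¬_; Dec)
open import Relation.Nullary.Decidable using (_→-dec_)
open import Relation.Unary using (Decidable)
open import Relation.Binary.PropositionalEquality using (_≡_; _≢_)
open import Algebra.Structures using (IsAbelianGroup)

-- A finite abelian group, presented (up to isomorphism) on the carrier Fin size,
-- written with stdlib's abelian-group structure over propositional equality.
record FinAbGroup : Set where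
  field
    size : ℕ
    _∙_ : Fin size → Fin size → Fin size
    ε : Fin size
    _⁻¹ : Fin size → Fin size
    isAbelianGroup : IsAbelianGroup _≡_ _∙_ ε _⁻¹

  Carrier : Set
  Carrier = Fin size

  mul : ℕ → Carrier → Carrier
  mul zero g = ε
  mul (suc m) g = g ∙ mul m g

  IsOrder : Carrier → ℕ → Set
  IsOrder g m = 0 < m × mul m g ≡ ε × (∀ j → 0 < j → j < m → mul j g ≢ ε)

  OrdDivides : Carrier → ℕ → Set
  OrdDivides g k = ∃ λ m → IsOrder g m × m ∣ k

  OrdNotDivides : Carrier → ℕ → Set
  OrdNotDivides g k = ∃ λ m → IsOrder g m × ¬ (m ∣ k)

  InSylow : ℕ → Carrier → Set
  InSylow ℓ g = ∃ λ m → IsOrder g m × ∃ λ e → m ≡ ℓ ^ e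

  IsℓGroup : ℕ → Set
  IsℓGroup ℓ = ∀ g → InSylow ℓ g

  InMultiples : ℕ → Carrier → Set
  InMultiples m x = ∃ λ s → mul m s ≡ x

  inMultiples? : (m : ℕ) → Decidable (InMultiples m)
  inMultiples? m x = any? (λ s → mul m s ≟ x)

  CosetRep : ℕ → Carrier → Set
  CosetRep m g = ∀ h → InMultiples m (h ∙ (g ⁻¹)) → toℕ g ≤ toℕ h

  cosetRep? : (m : ℕ) → Decidable (CosetRep m)
  cosetRep? m g = all? (λ h → inMultiples? m (h ∙ (g ⁻¹)) →-dec (toℕ g ℕP.≤? toℕ h))

  -- |G / mG| : the number of cosets of mG in G
  quotCard : ℕ → ℕ
  quotCard m = length (filter (cosetRep? m) (allFin size))

open FinAbGroup public using (Carrier)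

record Hom (G H : FinAbGroup) : Set where
  private
    module G = FinAbGroup G
    module H = FinAbGroup H
  field
    fun : G.Carrier → H.Carrier
    hom : ∀ x y → fun (x G.∙ y) ≡ fun x H.∙ fun y

IsValuation : ℕ → ℕ → ℕ → Set
IsValuation ℓ k r = (ℓ ^ r) ∣ k × ¬ ((ℓ ^ suc r) ∣ k)

-- Since ord(g) ∣ k iff k·g = 0, an element g is exceptional (ord g ∤ k but ord π(g) ∣ k) exactly
-- when k·g is a nonzero element of ker π, which is (a). Write k = q ℓ^r with ℓ ∤ q. Multiplication
-- by q is injective on ℓ-elements, so when ker π is an ℓ-group the ℓ-element q·g is exceptional
-- whenever g is, which gives (b). In (c), ker f = ⟨z⟩ has prime order ℓ, so ker f meets kG
-- nontrivially iff z ∈ ℓ^r G iff ker f ⊆ ℓ^r G. Finally f induces a surjection G/ℓ^rG → H/ℓ^rH,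
-- injective exactly when ker f ⊆ ℓ^r G. Counting cosets by their least-index representatives, a
-- section of this surjection injects the representatives of H into those of G, and misses one as
-- soon as two cosets of G have the same image.

module Submission where

open import Defs
open import Level using (0ℓ)
open import Data.Nat using (ℕ; zero; suc; _+_; _*_; _∸_; _^_; _≤_; _<_; _≥_; s≤s; >-nonZero)
open import Data.Nat.Properties as ℕ using (_<?_)
open import Data.Nat.Divisibility
  using (_∣_; _∣?_; divides; ∣-refl; ∣-trans; n∣m*n; m∣m*n; ∣1⇒≡1; *-cancelʳ-∣; m%n≡0⇒n∣m)
open import Data.Nat.DivMod using (_%_; _/_; m≡m%n+[m/n]*n; m%n<n)
open import Data.Nat.Coprimality using (Coprime; coprime-divisor; coprime-Bézout)
open import Data.Nat.GCD using (module Bézout)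
open import Data.Nat.Primality using (Prime; prime⇒irreducible; prime⇒nonZero)
open import Data.Fin using (Fin; zero; suc; toℕ; punchOut)
open import Data.Fin.Properties using (_≟_; any?; toℕ-injective; injective⇒≤; punchOut-injective; pigeonhole)
open import Data.List using (List; _∷_; length; filter; allFin; lookup)
open import Data.List.Relation.Unary.All as All using ()
open import Data.List.Relation.Unary.AllPairs using (_∷_)
open import Data.List.Relation.Unary.Any using (index)
open import Data.List.Relation.Unary.Any.Properties using (lookup-index)
open import Data.List.Relation.Unary.Unique.Propositional using (Unique)
open import Data.List.Relation.Unary.Unique.Propositional.Properties using (filter⁺; allFin⁺)
open import Data.List.Membership.Propositional.Properties using (∈-lookup; ∈-filter⁺; ∈-filter⁻; ∈-allFin)
open import Data.Product using (∃; _×_; _,_; proj₁; proj₂)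
open import Data.Sum using (inj₁; inj₂)
open import Function using (_∘_)
open import Function.Bundles using (_⇔_; mk⇔; module Equivalence)
open import Function.Definitions using (Injective)
open import Function.Properties.Equivalence using (⇔-setoid) renaming (sym to ⇔-sym)
open import Relation.Nullary using (¬_; yes; no; contradiction)
open import Relation.Nullary.Decidable using (_×-dec_; decidable-stable)
open import Relation.Unary using (Pred; Decidable)
open import Relation.Binary.PropositionalEquality
  using (_≡_; _≢_; refl; sym; trans; cong; subst; module ≡-Reasoning)
open import Algebra.Bundles using (AbelianGroup)
open import Algebra.Structures using (IsAbelianGroup)
import Algebra.Properties.AbelianGroup
import Algebra.Properties.CommutativeMonoid.Mult

least : ∀ {p} {P : Pred ℕ p} → Decidable P → ∀ {n} → P n → ∃ λ m → P m × (∀ {j} → j < m → ¬ P j)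
least P? {zero} p₀ = 0 , p₀ , λ ()
least P? {suc n} pₙ with P? 0
... | yes p₀ = 0 , p₀ , λ ()
... | no ¬p₀ with m , pₘ , below ← least (P? ∘ suc) pₙ =
  suc m , pₘ , λ { {zero} _ → ¬p₀ ; {suc j} (s≤s j<m) → below j<m }

module _ {ℓ : ℕ} (ℓ-prime : Prime ℓ) where

  ¬∣⇒coprime : ∀ {m} → ¬ ℓ ∣ m → Coprime m ℓ
  ¬∣⇒coprime ℓ∤m (i∣m , i∣ℓ) with prime⇒irreducible ℓ-prime i∣ℓ
  ... | inj₁ i≡1 = i≡1
  ... | inj₂ refl = contradiction i∣m ℓ∤m

  ∣ℓ^n⇒≡ℓ^e : ∀ n {m} → m ∣ ℓ ^ n → ∃ λ e → m ≡ ℓ ^ e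
  ∣ℓ^n⇒≡ℓ^e zero m∣1 = 0 , ∣1⇒≡1 m∣1
  ∣ℓ^n⇒≡ℓ^e (suc n) {m} m∣ℓ^[1+n] with ℓ ∣? m
  ... | no ℓ∤m = ∣ℓ^n⇒≡ℓ^e n (coprime-divisor (¬∣⇒coprime ℓ∤m) m∣ℓ^[1+n])
  ... | yes (divides c refl)
    with e , refl ← ∣ℓ^n⇒≡ℓ^e n {c} (*-cancelʳ-∣ ℓ {{prime⇒nonZero ℓ-prime}}
                                      (subst (c * ℓ ∣_) (ℕ.*-comm ℓ (ℓ ^ n)) m∣ℓ^[1+n]))
    = suc e , ℕ.*-comm (ℓ ^ e) ℓ

valuation⇒¬∣cofactor : ∀ {ℓ} q r → IsValuation ℓ (q * ℓ ^ r) r → ¬ ℓ ∣ q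
valuation⇒¬∣cofactor {ℓ} _ r (_ , ℓ^[1+r]∤k) (divides c refl) =
  ℓ^[1+r]∤k (divides c (ℕ.*-assoc c ℓ (ℓ ^ r)))

lookup-injective : ∀ {a} {A : Set a} {xs : List A} → Unique xs → Injective _≡_ _≡_ (lookup xs)
lookup-injective {xs = _ ∷ _} _ {zero} {zero} _ = refl
lookup-injective (x∉xs ∷ _) {zero} {suc j} eq = contradiction eq (All.lookup x∉xs (∈-lookup j))
lookup-injective (x∉xs ∷ _) {suc i} {zero} eq = contradiction (sym eq) (All.lookup x∉xs (∈-lookup i))
lookup-injective (_ ∷ unique) {suc i} {suc j} eq = cong suc (lookup-injective unique eq)

injective∧missing⇒< : ∀ {m n} {f : Fin m → Fin n} → Injective _≡_ _≡_ f →
                      ∀ c → (∀ i → f i ≢ c) → m < n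
injective∧missing⇒< {n = suc _} {f} f-inj c f≢c =
  s≤s (injective⇒≤ (λ eq → f-inj (punchOut-injective (f≢c _ ∘ sym) (f≢c _ ∘ sym) eq)))

module _ {n p} {P : Pred (Fin n) p} (P? : Decidable P) where

  card : ℕ
  card = length (filter P? (allFin n))

  element : Fin card → Fin n
  element = lookup (filter P? (allFin n))

  element-injective : Injective _≡_ _≡_ element
  element-injective = lookup-injective (filter⁺ P? (allFin⁺ n))

  element-satisfies : ∀ i → P (element i)
  element-satisfies i = proj₂ (∈-filter⁻ P? {xs = allFin n} (∈-lookup i))

  position : ∀ {x} → P x → Fin card
  position {x} px = index (∈-filter⁺ P? (∈-allFin x) px)

  element-position : ∀ {x} (px : P x) → element (position px) ≡ x
  element-position {x} px = sym (lookup-index (∈-filter⁺ P? (∈-allFin x) px))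

module _ {m n p q} {Q : Pred (Fin m) q} {P : Pred (Fin n) p} (Q? : Decidable Q) (P? : Decidable P)
         (β : Fin m → Fin n) (γ : Fin n → Fin m)
         (β-satisfies : ∀ {y} → Q y → P (β y)) (γ∘β≗id : ∀ {y} → Q y → γ (β y) ≡ y) where

  private
    transfer : Fin (card Q?) → Fin (card P?)
    transfer i = position P? (β-satisfies (element-satisfies Q? i))

    element-transfer : ∀ i → element P? (transfer i) ≡ β (element Q? i)
    element-transfer i = element-position P? (β-satisfies (element-satisfies Q? i))

    transfer-injective : Injective _≡_ _≡_ transfer
    transfer-injective {i} {j} eq = element-injective Q? (begin
      element Q? i                    ≡⟨ sym (γ∘β≗id (element-satisfies Q? i)) ⟩
      γ (β (element Q? i))            ≡⟨ cong γ (sym (element-transfer i)) ⟩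
      γ (element P? (transfer i))     ≡⟨ cong (γ ∘ element P?) eq ⟩
      γ (element P? (transfer j))     ≡⟨ cong γ (element-transfer j) ⟩
      γ (β (element Q? j))            ≡⟨ γ∘β≗id (element-satisfies Q? j) ⟩
      element Q? j                    ∎)
      where open ≡-Reasoning

  card-≤ : card Q? ≤ card P?
  card-≤ = injective⇒≤ transfer-injective

  missed⇒card-< : ∀ {c} → (pc : P c) → (∀ {y} → Q y → β y ≢ c) → card Q? < card P?
  missed⇒card-< pc missed = injective∧missing⇒< transfer-injective (position P? pc) λ i eq →
    missed (element-satisfies Q? i)
      (trans (sym (element-transfer i)) (trans (cong (element P?) eq) (element-position P? pc)))

  collapsed⇒card-< : ∀ {a b} → P a → P b → a ≢ b → γ a ≡ γ b → card Q? < card P?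
  collapsed⇒card-< {a} {b} pa pb a≢b γa≡γb with β (γ a) ≟ a
  ... | yes βγa≡a = missed⇒card-< pb λ {y} qy βy≡b → a≢b (begin
    a            ≡⟨ sym βγa≡a ⟩
    β (γ a)      ≡⟨ cong β γa≡γb ⟩
    β (γ b)      ≡⟨ cong (β ∘ γ) (sym βy≡b) ⟩
    β (γ (β y))  ≡⟨ cong β (γ∘β≗id qy) ⟩
    β y          ≡⟨ βy≡b ⟩
    b            ∎)
    where open ≡-Reasoning
  ... | no βγa≢a = missed⇒card-< pa λ {y} qy βy≡a → βγa≢a (begin
    β (γ a)      ≡⟨ cong (β ∘ γ) (sym βy≡a) ⟩
    β (γ (β y))  ≡⟨ cong β (γ∘β≗id qy) ⟩
    β y          ≡⟨ βy≡a ⟩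
    a            ∎)
    where open ≡-Reasoning

module FinAbGroupProperties (G : FinAbGroup) where
  open FinAbGroup G public hiding (Carrier)
  open IsAbelianGroup isAbelianGroup public using (assoc; identityˡ; identityʳ; inverseˡ; inverseʳ)

  abelianGroup : AbelianGroup 0ℓ 0ℓ
  abelianGroup = record { isAbelianGroup = isAbelianGroup }

  open Algebra.Properties.AbelianGroup abelianGroup public
    using (identityˡ-unique; inverseʳ-unique; ε⁻¹≈ε; ⁻¹-involutive; ⁻¹-anti-homo‿-)
  open Algebra.Properties.CommutativeMonoid.Mult (AbelianGroup.commutativeMonoid abelianGroup)
    using (×-homo-+; ×-assocˡ; ×-distrib-+)
    renaming (_×_ to _·_)

  mul≗× : ∀ n g → mul n g ≡ n · g
  mul≗× zero    g = refl
  mul≗× (suc n) g = cong (g ∙_) (mul≗× n g)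

  mul-homo-+ : ∀ m n g → mul (m + n) g ≡ mul m g ∙ mul n g
  mul-homo-+ m n g rewrite mul≗× (m + n) g | mul≗× m g | mul≗× n g = ×-homo-+ g m n

  mul-assoc : ∀ m n g → mul m (mul n g) ≡ mul (m * n) g
  mul-assoc m n g rewrite mul≗× n g | mul≗× m (n · g) | mul≗× (m * n) g = ×-assocˡ g m n

  mul-distrib-∙ : ∀ n g h → mul n (g ∙ h) ≡ mul n g ∙ mul n h
  mul-distrib-∙ n g h rewrite mul≗× n (g ∙ h) | mul≗× n g | mul≗× n h = ×-distrib-+ g h n

  mulHom : ℕ → Hom G G
  mulHom n = record { fun = mul n ; hom = mul-distrib-∙ n }

module HomProperties {G H : FinAbGroup} (f : Hom G H) where
  private
    module G = FinAbGroupProperties G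
    module H = FinAbGroupProperties H
  open Hom f

  fun-ε : fun G.ε ≡ H.ε
  fun-ε = H.identityˡ-unique (fun G.ε) (fun G.ε) (trans (sym (hom G.ε G.ε)) (cong fun (G.identityˡ G.ε)))

  fun-⁻¹ : ∀ x → fun (x G.⁻¹) ≡ (fun x) H.⁻¹
  fun-⁻¹ x = H.inverseʳ-unique (fun x) (fun (x G.⁻¹))
    (trans (sym (hom x (x G.⁻¹))) (trans (cong fun (G.inverseʳ x)) fun-ε))

  fun-mul : ∀ n x → fun (G.mul n x) ≡ H.mul n (fun x)
  fun-mul zero    x = fun-ε
  fun-mul (suc n) x = trans (hom x (G.mul n x)) (cong (fun x H.∙_) (fun-mul n x))

  fun-∙⁻¹ : ∀ a b → fun (a G.∙ (b G.⁻¹)) ≡ fun a H.∙ ((fun b) H.⁻¹)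
  fun-∙⁻¹ a b = trans (hom a (b G.⁻¹)) (cong (fun a H.∙_) (fun-⁻¹ b))

  fun≡⇒∙⁻¹∈kernel : ∀ {a b} → fun a ≡ fun b → fun (a G.∙ (b G.⁻¹)) ≡ H.ε
  fun≡⇒∙⁻¹∈kernel {a} {b} fa≡fb =
    trans (fun-∙⁻¹ a b) (trans (cong (H._∙ ((fun b) H.⁻¹)) fa≡fb) (H.inverseʳ (fun b)))

  fun-InMultiples : ∀ m {x} → G.InMultiples m x → H.InMultiples m (fun x)
  fun-InMultiples m (s , refl) = fun s , sym (fun-mul m s)

  KernelInMultiples : ℕ → Set
  KernelInMultiples m = ∀ x → fun x ≡ H.ε → G.InMultiples m x

  Image : Pred (Carrier H) 0ℓ
  Image y = ∃ λ x → fun x ≡ y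

  image-ε : Image H.ε
  image-ε = G.ε , fun-ε

  image-∙ : ∀ {y z} → Image y → Image z → Image (y H.∙ z)
  image-∙ (x , refl) (w , refl) = x G.∙ w , hom x w

  image-⁻¹ : ∀ {y} → Image y → Image (y H.⁻¹)
  image-⁻¹ (x , refl) = x G.⁻¹ , fun-⁻¹ x

  image-mul : ∀ n {y} → Image y → Image (H.mul n y)
  image-mul n (x , refl) = G.mul n x , fun-mul n x

module FinAbGroupOrder (G : FinAbGroup) where
  open FinAbGroupProperties G
  open HomProperties using (Image; image-⁻¹; image-mul)

  mul-ε : ∀ n → mul n ε ≡ ε
  mul-ε n = HomProperties.fun-ε (mulHom n)

  mul-comm : ∀ m n g → mul m (mul n g) ≡ mul n (mul m g)
  mul-comm m = HomProperties.fun-mul (mulHom m)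

  mul-mul-comm : ∀ m n g → mul m (mul n g) ≡ mul (n * m) g
  mul-mul-comm m n g = trans (mul-comm m n g) (mul-assoc n m g)

  period : ∀ g → ∃ λ d → 0 < d × mul d g ≡ ε
  period g with i , j , i<j , mulᵢ≡mulⱼ ← pigeonhole (ℕ.n<1+n size) (λ (i : Fin (suc size)) → mul (toℕ i) g)
    = toℕ j ∸ toℕ i , ℕ.m<n⇒0<n∸m i<j , identityˡ-unique _ _ (begin
      mul (toℕ j ∸ toℕ i) g ∙ mul (toℕ i) g  ≡⟨ sym (mul-homo-+ (toℕ j ∸ toℕ i) (toℕ i) g) ⟩
      mul (toℕ j ∸ toℕ i + toℕ i) g          ≡⟨ cong (λ t → mul t g) (ℕ.m∸n+n≡m (ℕ.<⇒≤ i<j)) ⟩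
      mul (toℕ j) g                          ≡⟨ sym mulᵢ≡mulⱼ ⟩
      mul (toℕ i) g                          ∎)
    where open ≡-Reasoning

  order : ∀ g → ∃ (IsOrder g)
  order g with d , 0<d , dg≡ε ← period g
    with n , (0<n , ng≡ε) , below ← least (λ j → 0 <? j ×-dec mul j g ≟ ε) (0<d , dg≡ε)
    = n , 0<n , ng≡ε , λ j 0<j j<n jg≡ε → below j<n (0<j , jg≡ε)

  IsOrder⇒mul≡ε : ∀ {g n j} → IsOrder g n → n ∣ j → mul j g ≡ ε
  IsOrder⇒mul≡ε {g} {n} (_ , ng≡ε , _) (divides q refl) = begin
    mul (q * n) g  ≡⟨ sym (mul-assoc q n g) ⟩
    mul q (mul n g) ≡⟨ cong (mul q) ng≡ε ⟩
    mul q ε        ≡⟨ mul-ε q ⟩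
    ε              ∎
    where open ≡-Reasoning

  IsOrder⇒∣ : ∀ {g n j} → IsOrder g n → mul j g ≡ ε → n ∣ j
  IsOrder⇒∣ {g} {n} {j} o@(0<n , _ , below) jg≡ε =
    m%n≡0⇒n∣m j n (ℕ.n≤0⇒n≡0 (ℕ.≮⇒≥ λ 0<r → below (j % n) 0<r (m%n<n j n) rg≡ε))
    where
    instance _ = >-nonZero 0<n
    open ≡-Reasoning
    rg≡ε : mul (j % n) g ≡ ε
    rg≡ε = begin
      mul (j % n) g                      ≡⟨ sym (identityʳ _) ⟩
      mul (j % n) g ∙ ε                  ≡⟨ cong (mul (j % n) g ∙_) (sym (IsOrder⇒mul≡ε o (n∣m*n (j / n)))) ⟩
      mul (j % n) g ∙ mul (j / n * n) g  ≡⟨ sym (mul-homo-+ (j % n) (j / n * n) g) ⟩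
      mul (j % n + j / n * n) g          ≡⟨ cong (λ t → mul t g) (sym (m≡m%n+[m/n]*n j n)) ⟩
      mul j g                            ≡⟨ jg≡ε ⟩
      ε                                  ∎

  OrdDivides⇔ : ∀ {g k} → OrdDivides g k ⇔ mul k g ≡ ε
  OrdDivides⇔ {g} = mk⇔ (λ (_ , o , n∣k) → IsOrder⇒mul≡ε o n∣k)
                        (λ kg≡ε → let n , o = order g in n , o , IsOrder⇒∣ o kg≡ε)

  OrdNotDivides⇔ : ∀ {g k} → OrdNotDivides g k ⇔ mul k g ≢ ε
  OrdNotDivides⇔ {g} = mk⇔ (λ (_ , o , n∤k) kg≡ε → n∤k (IsOrder⇒∣ o kg≡ε))
                           (λ kg≢ε → let n , o = order g in n , o , λ n∣k → kg≢ε (IsOrder⇒mul≡ε o n∣k))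

  coprime-multiple∈image⇒∈image : ∀ {K} (f : Hom K G) {z n j} → IsOrder z n → Coprime j n →
                                   Image f (mul j z) → Image f z
  coprime-multiple∈image⇒∈image f {z} {n} {j} o j⊥n jz∈f with coprime-Bézout j⊥n
  ... | Bézout.+- x y 1+yn≡xj = subst (Image f) xjz≡z (image-mul f x jz∈f)
    where
    open ≡-Reasoning
    xjz≡z : mul x (mul j z) ≡ z
    xjz≡z = begin
      mul x (mul j z)      ≡⟨ mul-assoc x j z ⟩
      mul (x * j) z        ≡⟨ cong (λ t → mul t z) (sym 1+yn≡xj) ⟩
      z ∙ mul (y * n) z    ≡⟨ cong (z ∙_) (IsOrder⇒mul≡ε o (n∣m*n y)) ⟩
      z ∙ ε                ≡⟨ identityʳ z ⟩
      z                    ∎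
  ... | Bézout.-+ x y 1+xj≡yn =
    subst (Image f) (⁻¹-involutive z) (image-⁻¹ f (subst (Image f) xjz≡z⁻¹ (image-mul f x jz∈f)))
    where
    open ≡-Reasoning
    xjz≡z⁻¹ : mul x (mul j z) ≡ z ⁻¹
    xjz≡z⁻¹ = inverseʳ-unique z (mul x (mul j z)) (begin
      z ∙ mul x (mul j z)  ≡⟨ cong (z ∙_) (mul-assoc x j z) ⟩
      mul (1 + x * j) z    ≡⟨ cong (λ t → mul t z) 1+xj≡yn ⟩
      mul (y * n) z        ≡⟨ IsOrder⇒mul≡ε o (n∣m*n y) ⟩
      ε                    ∎)

module FinAbGroupSylow (G : FinAbGroup) {ℓ} (ℓ-prime : Prime ℓ) where
  open FinAbGroupProperties G
  open FinAbGroupOrder G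

  InSylow⇔ : ∀ {g} → InSylow ℓ g ⇔ ∃ λ e → mul (ℓ ^ e) g ≡ ε
  InSylow⇔ {g} = mk⇔
    (λ { (_ , o , e , refl) → e , IsOrder⇒mul≡ε o ∣-refl })
    (λ (e , ℓ^e·g≡ε) → let n , o = order g in n , o , ∣ℓ^n⇒≡ℓ^e ℓ-prime e (IsOrder⇒∣ o ℓ^e·g≡ε))

  InSylow-mul : ∀ t {g} → InSylow ℓ g → InSylow ℓ (mul t g)
  InSylow-mul t {g} g∈S with e , ℓ^e·g≡ε ← Equivalence.to InSylow⇔ g∈S =
    Equivalence.from InSylow⇔ (e , trans (mul-comm (ℓ ^ e) t g) (trans (cong (mul t) ℓ^e·g≡ε) (mul-ε t)))

  InSylow-ℓ^-multiple : ∀ r {g} → InSylow ℓ (mul (ℓ ^ r) g) → InSylow ℓ g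
  InSylow-ℓ^-multiple r {g} ℓ^r·g∈S with e , ℓ^e·ℓ^r·g≡ε ← Equivalence.to InSylow⇔ ℓ^r·g∈S =
    Equivalence.from InSylow⇔ (e + r , (begin
      mul (ℓ ^ (e + r)) g        ≡⟨ cong (λ t → mul t g) (ℕ.^-distribˡ-+-* ℓ e r) ⟩
      mul (ℓ ^ e * ℓ ^ r) g      ≡⟨ sym (mul-assoc (ℓ ^ e) (ℓ ^ r) g) ⟩
      mul (ℓ ^ e) (mul (ℓ ^ r) g) ≡⟨ ℓ^e·ℓ^r·g≡ε ⟩
      ε                          ∎))
    where open ≡-Reasoning

  InSylow⇒mul-coprime≢ε : ∀ {g q} → InSylow ℓ g → ¬ ℓ ∣ q → g ≢ ε → mul q g ≢ ε
  InSylow⇒mul-coprime≢ε {g} (_ , (_ , g∙ε≡ε , _) , zero , refl) _ g≢ε _ =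
    g≢ε (trans (sym (identityʳ g)) g∙ε≡ε)
  InSylow⇒mul-coprime≢ε (_ , o , suc e , refl) ℓ∤q _ qg≡ε =
    ℓ∤q (∣-trans (m∣m*n (ℓ ^ e)) (IsOrder⇒∣ o qg≡ε))

module Cosets (G : FinAbGroup) (m : ℕ) where
  open FinAbGroupProperties G
  open HomProperties (mulHom m) using (image-ε; image-∙; image-⁻¹)

  _~_ : Carrier G → Carrier G → Set
  a ~ b = InMultiples m (a ∙ (b ⁻¹))

  ~-refl : ∀ {a} → a ~ a
  ~-refl {a} = subst (InMultiples m) (sym (inverseʳ a)) image-ε

  ~-sym : ∀ {a b} → a ~ b → b ~ a
  ~-sym {a} {b} a~b = subst (InMultiples m) (⁻¹-anti-homo‿- a b) (image-⁻¹ a~b)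

  ~-trans : ∀ {a b c} → a ~ b → b ~ c → a ~ c
  ~-trans {a} {b} {c} a~b b~c = subst (InMultiples m) telescope (image-∙ a~b b~c)
    where
    open ≡-Reasoning
    telescope : (a ∙ (b ⁻¹)) ∙ (b ∙ (c ⁻¹)) ≡ a ∙ (c ⁻¹)
    telescope = begin
      (a ∙ (b ⁻¹)) ∙ (b ∙ (c ⁻¹))  ≡⟨ assoc a (b ⁻¹) (b ∙ (c ⁻¹)) ⟩
      a ∙ ((b ⁻¹) ∙ (b ∙ (c ⁻¹)))  ≡⟨ cong (a ∙_) (sym (assoc (b ⁻¹) b (c ⁻¹))) ⟩
      a ∙ (((b ⁻¹) ∙ b) ∙ (c ⁻¹))  ≡⟨ cong (λ t → a ∙ (t ∙ (c ⁻¹))) (inverseˡ b) ⟩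
      a ∙ (ε ∙ (c ⁻¹))             ≡⟨ cong (a ∙_) (identityˡ (c ⁻¹)) ⟩
      a ∙ (c ⁻¹)                   ∎

  ~ε⇔InMultiples : ∀ {a} → a ~ ε ⇔ InMultiples m a
  ~ε⇔InMultiples {a} = mk⇔ (subst (InMultiples m) a∙ε⁻¹≡a) (subst (InMultiples m) (sym a∙ε⁻¹≡a))
    where
    a∙ε⁻¹≡a : a ∙ (ε ⁻¹) ≡ a
    a∙ε⁻¹≡a = trans (cong (a ∙_) ε⁻¹≈ε) (identityʳ a)

  representative : ∀ g → ∃ λ i → CosetRep m i × i ~ g
  representative g
    with _ , (i , refl , i~g) , below ←
           least (λ j → any? λ h → toℕ h ℕ.≟ j ×-dec inMultiples? m (h ∙ (g ⁻¹))) (g , refl , ~-refl)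
    = i , (λ h h~i → ℕ.≮⇒≥ λ h<i → below h<i (h , refl , ~-trans h~i i~g)) , i~g

  rep : Carrier G → Carrier G
  rep g = proj₁ (representative g)

  rep-CosetRep : ∀ g → CosetRep m (rep g)
  rep-CosetRep g = proj₁ (proj₂ (representative g))

  rep~ : ∀ g → rep g ~ g
  rep~ g = proj₂ (proj₂ (representative g))

  CosetRep-unique : ∀ {i j} → CosetRep m i → CosetRep m j → i ~ j → i ≡ j
  CosetRep-unique {i} {j} i-rep j-rep i~j = toℕ-injective (ℕ.≤-antisym (i-rep j (~-sym i~j)) (j-rep i i~j))

  rep-cong : ∀ {a b} → a ~ b → rep a ≡ rep b
  rep-cong {a} {b} a~b = CosetRep-unique (rep-CosetRep a) (rep-CosetRep b) (~-trans (rep~ a) (~-trans a~b (~-sym (rep~ b))))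

  rep-CosetRep-fixed : ∀ {i} → CosetRep m i → rep i ≡ i
  rep-CosetRep-fixed {i} i-rep = CosetRep-unique (rep-CosetRep i) i-rep (rep~ i)

module QuotientCard {G H : FinAbGroup} (f : Hom G H) (f-surjective : ∀ y → HomProperties.Image f y) (m : ℕ) where
  private
    module G = FinAbGroupProperties G
    module H = FinAbGroupProperties H
    module CG = Cosets G m
    module CH = Cosets H m
  open Hom f
  open HomProperties f

  fun-~ : ∀ {a b} → a CG.~ b → fun a CH.~ fun b
  fun-~ {a} {b} a~b = subst (H.InMultiples m) (fun-∙⁻¹ a b) (fun-InMultiples m a~b)

  KernelInMultiples⇒reflect-~ : KernelInMultiples m → ∀ {a b} → fun a CH.~ fun b → a CG.~ b
  KernelInMultiples⇒reflect-~ ker⊆mG {a} {b} (t , mt≡fa∙fb⁻¹) with u , refl ← f-surjective t =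
    Equivalence.to CG.~ε⇔InMultiples (CG.~-trans a∙b⁻¹~mu (Equivalence.from CG.~ε⇔InMultiples (u , refl)))
    where
    a∙b⁻¹~mu : (a G.∙ (b G.⁻¹)) CG.~ G.mul m u
    a∙b⁻¹~mu = ker⊆mG _ (fun≡⇒∙⁻¹∈kernel
      (trans (fun-∙⁻¹ a b) (trans (sym mt≡fa∙fb⁻¹) (sym (fun-mul m u)))))

  lift : Carrier H → Carrier G
  lift y = CG.rep (proj₁ (f-surjective y))

  push : Carrier G → Carrier H
  push x = CH.rep (fun x)

  lift-CosetRep : ∀ y → G.CosetRep m (lift y)
  lift-CosetRep y = CG.rep-CosetRep (proj₁ (f-surjective y))

  push-CosetRep : ∀ x → H.CosetRep m (push x)
  push-CosetRep x = CH.rep-CosetRep (fun x)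

  push∘rep : ∀ a → push (CG.rep a) ≡ CH.rep (fun a)
  push∘rep a = CH.rep-cong (fun-~ (CG.rep~ a))

  push∘lift : ∀ {y} → H.CosetRep m y → push (lift y) ≡ y
  push∘lift {y} y-rep with u , refl ← f-surjective y = trans (push∘rep u) (CH.rep-CosetRep-fixed y-rep)

  lift∘push : KernelInMultiples m → ∀ {x} → G.CosetRep m x → lift (push x) ≡ x
  lift∘push ker⊆mG {x} x-rep with u , fu≡ ← f-surjective (push x) =
    trans (CG.rep-cong (KernelInMultiples⇒reflect-~ ker⊆mG (subst (CH._~ fun x) (sym fu≡) (CH.rep~ (fun x)))))
          (CG.rep-CosetRep-fixed x-rep)

  quotCard-≤ : H.quotCard m ≤ G.quotCard m
  quotCard-≤ = card-≤ (H.cosetRep? m) (G.cosetRep? m) lift push (λ {y} _ → lift-CosetRep y) push∘lift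

  quotCard≡⇔KernelInMultiples : G.quotCard m ≡ H.quotCard m ⇔ KernelInMultiples m
  quotCard≡⇔KernelInMultiples = mk⇔ to from
    where
    to : G.quotCard m ≡ H.quotCard m → KernelInMultiples m
    to |G/mG|≡|H/mH| x fx≡ε = decidable-stable (G.inMultiples? m x) λ x∉mG →
      ℕ.<-irrefl (sym |G/mG|≡|H/mH|)
        (collapsed⇒card-< (H.cosetRep? m) (G.cosetRep? m) lift push (λ {y} _ → lift-CosetRep y) push∘lift
          (CG.rep-CosetRep G.ε) (CG.rep-CosetRep x) (rep-ε≢rep-x x∉mG) push-rep-ε≡push-rep-x)
      where
      rep-ε≢rep-x : ¬ G.InMultiples m x → CG.rep G.ε ≢ CG.rep x
      rep-ε≢rep-x x∉mG repε≡repx = x∉mG (Equivalence.to CG.~ε⇔InMultiples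
        (CG.~-trans (CG.~-sym (CG.rep~ x)) (subst (CG._~ G.ε) repε≡repx (CG.rep~ G.ε))))

      push-rep-ε≡push-rep-x : push (CG.rep G.ε) ≡ push (CG.rep x)
      push-rep-ε≡push-rep-x =
        trans (push∘rep G.ε) (trans (cong CH.rep (trans fun-ε (sym fx≡ε))) (sym (push∘rep x)))

    from : KernelInMultiples m → G.quotCard m ≡ H.quotCard m
    from ker⊆mG = ℕ.≤-antisym
      (card-≤ (G.cosetRep? m) (H.cosetRep? m) push lift (λ {x} _ → push-CosetRep x) (lift∘push ker⊆mG))
      quotCard-≤

module ExceptionalElements {G H : FinAbGroup} (f : Hom G H) where
  private
    module G = FinAbGroupProperties G
    module H = FinAbGroupProperties H
    module OG = FinAbGroupOrder G
    module OH = FinAbGroupOrder H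
  open Hom f
  open HomProperties f

  Exceptional : ℕ → Pred (Carrier G) 0ℓ
  Exceptional k g = G.OrdNotDivides g k × H.OrdDivides (fun g) k

  Exceptional⇔ : ∀ {k g} → Exceptional k g ⇔ (G.mul k g ≢ G.ε × fun (G.mul k g) ≡ H.ε)
  Exceptional⇔ {k} {g} = mk⇔
    (λ (k∤ord-g , ord-fg∣k) → Equivalence.to OG.OrdNotDivides⇔ k∤ord-g ,
                              trans (fun-mul k g) (Equivalence.to OH.OrdDivides⇔ ord-fg∣k))
    (λ (kg≢ε , fkg≡ε) → Equivalence.from OG.OrdNotDivides⇔ kg≢ε ,
                        Equivalence.from OH.OrdDivides⇔ (trans (sym (fun-mul k g)) fkg≡ε))

  KernelMeetsMultiples : ℕ → Set
  KernelMeetsMultiples k = ∃ λ x → x ≢ G.ε × fun x ≡ H.ε × G.InMultiples k x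

  kernel-mul : ∀ n {x} → fun x ≡ H.ε → fun (G.mul n x) ≡ H.ε
  kernel-mul n {x} fx≡ε = trans (fun-mul n x) (trans (cong (H.mul n) fx≡ε) (OH.mul-ε n))

  exceptional⇔kernelMeetsMultiples : ∀ k → (∃ (Exceptional k)) ⇔ KernelMeetsMultiples k
  exceptional⇔kernelMeetsMultiples k = mk⇔
    (λ (g , g-exc) → let kg≢ε , fkg≡ε = Equivalence.to Exceptional⇔ g-exc in
                     G.mul k g , kg≢ε , fkg≡ε , g , refl)
    (λ { (_ , x≢ε , fx≡ε , s , refl) → s , Equivalence.from Exceptional⇔ (x≢ε , fx≡ε) })

  module _ {ℓ} (ℓ-prime : Prime ℓ) {q} (ℓ∤q : ¬ ℓ ∣ q) (r : ℕ) where
    private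
      module SG = FinAbGroupSylow G ℓ-prime

      exceptional-from-kernel : ∀ {s x} → G.mul (q * ℓ ^ r) s ≡ G.mul q x →
                                G.InSylow ℓ x → x ≢ G.ε → fun x ≡ H.ε → Exceptional (q * ℓ ^ r) s
      exceptional-from-kernel ks≡qx x∈S x≢ε fx≡ε = Equivalence.from Exceptional⇔
        ( (λ ks≡ε → SG.InSylow⇒mul-coprime≢ε x∈S ℓ∤q x≢ε (trans (sym ks≡qx) ks≡ε))
        , subst (λ t → fun t ≡ H.ε) (sym ks≡qx) (kernel-mul q fx≡ε))

    exceptional⇔exceptional-in-Sylow : (∀ x → fun x ≡ H.ε → G.InSylow ℓ x) →
      (∃ (Exceptional (q * ℓ ^ r))) ⇔ (∃ λ s → G.InSylow ℓ s × Exceptional (q * ℓ ^ r) s)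
    exceptional⇔exceptional-in-Sylow kernel⊆Sylow = mk⇔ to (λ (s , _ , s-exc) → s , s-exc)
      where
      to : ∃ (Exceptional (q * ℓ ^ r)) → ∃ λ s → G.InSylow ℓ s × Exceptional (q * ℓ ^ r) s
      to (g , g-exc) with kg≢ε , fkg≡ε ← Equivalence.to Exceptional⇔ g-exc =
        G.mul q g ,
        SG.InSylow-ℓ^-multiple r (subst (G.InSylow ℓ) (sym (OG.mul-mul-comm (ℓ ^ r) q g)) kg∈S) ,
        exceptional-from-kernel (OG.mul-comm (q * ℓ ^ r) q g) kg∈S kg≢ε fkg≡ε
        where
        kg∈S : G.InSylow ℓ (G.mul (q * ℓ ^ r) g)
        kg∈S = kernel⊆Sylow _ fkg≡ε

    exceptional-in-Sylow⇔kernel∩Sylow-multiples :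
      (∃ λ s → G.InSylow ℓ s × Exceptional (q * ℓ ^ r) s) ⇔
      (∃ λ x → G.InSylow ℓ x × x ≢ G.ε × fun x ≡ H.ε × ∃ λ s → G.InSylow ℓ s × G.mul (ℓ ^ r) s ≡ x)
    exceptional-in-Sylow⇔kernel∩Sylow-multiples = mk⇔
      (λ (s , s∈S , s-exc) → let ks≢ε , fks≡ε = Equivalence.to Exceptional⇔ s-exc in
         G.mul (q * ℓ ^ r) s , SG.InSylow-mul (q * ℓ ^ r) s∈S , ks≢ε , fks≡ε ,
         G.mul q s , SG.InSylow-mul q s∈S , OG.mul-mul-comm (ℓ ^ r) q s)
      (λ { (x , x∈S , x≢ε , fx≡ε , s , s∈S , refl) →
         s , s∈S , exceptional-from-kernel (sym (G.mul-assoc q (ℓ ^ r) s)) x∈S x≢ε fx≡ε })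

  module _ {z} (fz≡ε : fun z ≡ H.ε) (kernel⊆⟨z⟩ : ∀ x → fun x ≡ H.ε → ∃ λ j → x ≡ G.mul j z) where

    z∈multiples⇔KernelInMultiples : ∀ m → G.InMultiples m z ⇔ KernelInMultiples m
    z∈multiples⇔KernelInMultiples m = mk⇔
      (λ z∈mG x fx≡ε → let j , x≡jz = kernel⊆⟨z⟩ x fx≡ε in
         subst (G.InMultiples m) (sym x≡jz) (HomProperties.image-mul (G.mulHom m) j z∈mG))
      (λ kernel⊆mG → kernel⊆mG z fz≡ε)

    module _ {ℓ} (ℓ-prime : Prime ℓ) (z-order : G.IsOrder z ℓ) {q} (ℓ∤q : ¬ ℓ ∣ q) (r : ℕ) where

      kernelMeetsMultiples⇔z∈multiples : KernelMeetsMultiples (q * ℓ ^ r) ⇔ G.InMultiples (ℓ ^ r) z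
      kernelMeetsMultiples⇔z∈multiples = mk⇔ to from
        where
        to : KernelMeetsMultiples (q * ℓ ^ r) → G.InMultiples (ℓ ^ r) z
        to (_ , x≢ε , fx≡ε , s , refl) with j , ks≡jz ← kernel⊆⟨z⟩ _ fx≡ε =
          OG.coprime-multiple∈image⇒∈image (G.mulHom (ℓ ^ r)) z-order (¬∣⇒coprime ℓ-prime ℓ∤j)
            (G.mul q s , trans (OG.mul-mul-comm (ℓ ^ r) q s) ks≡jz)
          where
          ℓ∤j : ¬ ℓ ∣ j
          ℓ∤j ℓ∣j = x≢ε (trans ks≡jz (OG.IsOrder⇒mul≡ε z-order ℓ∣j))
        from : G.InMultiples (ℓ ^ r) z → KernelMeetsMultiples (q * ℓ ^ r)
        from (s , ℓ^r·s≡z) =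
          G.mul q z , (λ qz≡ε → ℓ∤q (OG.IsOrder⇒∣ z-order qz≡ε)) , kernel-mul q fz≡ε ,
          s , trans (sym (G.mul-assoc q (ℓ ^ r) s)) (cong (G.mul q) ℓ^r·s≡z)

      exceptional⇔quotCard≡ : (∀ y → Image y) →
        (∃ (Exceptional (q * ℓ ^ r))) ⇔ (G.quotCard (ℓ ^ r) ≡ H.quotCard (ℓ ^ r))
      exceptional⇔quotCard≡ f-surjective = begin
        ∃ (Exceptional (q * ℓ ^ r))                    ≈⟨ exceptional⇔kernelMeetsMultiples (q * ℓ ^ r) ⟩
        KernelMeetsMultiples (q * ℓ ^ r)               ≈⟨ kernelMeetsMultiples⇔z∈multiples ⟩
        G.InMultiples (ℓ ^ r) z                        ≈⟨ z∈multiples⇔KernelInMultiples (ℓ ^ r) ⟩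
        KernelInMultiples (ℓ ^ r)                      ≈⟨ ⇔-sym quotCard≡⇔KernelInMultiples ⟩
        G.quotCard (ℓ ^ r) ≡ H.quotCard (ℓ ^ r)        ∎
        where
        open QuotientCard f f-surjective (ℓ ^ r) using (quotCard≡⇔KernelInMultiples)
        open import Relation.Binary.Reasoning.Setoid (⇔-setoid 0ℓ)

lemma4p7 :
  -- (a)
  (∀ (k : ℕ) → k ≥ 1 → (G H : FinAbGroup) → (π : Hom G H) →
    (∃ λ (g : Carrier G) → FinAbGroup.OrdNotDivides G g k × FinAbGroup.OrdDivides H (Hom.fun π g) k)
    ⇔
    (∃ λ (x : Carrier G) → x ≢ FinAbGroup.ε G × Hom.fun π x ≡ FinAbGroup.ε H
       × FinAbGroup.InMultiples G k x))
  ×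
  -- (b)
  (∀ (k : ℕ) → k ≥ 1 → (G H : FinAbGroup) → (π : Hom G H) → (ℓ : ℕ) → Prime ℓ →
    (∀ (x : Carrier G) → Hom.fun π x ≡ FinAbGroup.ε H → FinAbGroup.InSylow G ℓ x) →
    (r : ℕ) → IsValuation ℓ k r →
    ((∃ λ (g : Carrier G) → FinAbGroup.OrdNotDivides G g k × FinAbGroup.OrdDivides H (Hom.fun π g) k)
     ⇔
     (∃ λ (s : Carrier G) → FinAbGroup.InSylow G ℓ s
        × FinAbGroup.OrdNotDivides G s k × FinAbGroup.OrdDivides H (Hom.fun π s) k))
    ×
    ((∃ λ (s : Carrier G) → FinAbGroup.InSylow G ℓ s
        × FinAbGroup.OrdNotDivides G s k × FinAbGroup.OrdDivides H (Hom.fun π s) k)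
     ⇔
     (∃ λ (x : Carrier G) → FinAbGroup.InSylow G ℓ x × x ≢ FinAbGroup.ε G
        × Hom.fun π x ≡ FinAbGroup.ε H
        × ∃ λ (s : Carrier G) → FinAbGroup.InSylow G ℓ s × FinAbGroup.mul G (ℓ ^ r) s ≡ x)))
  ×
  -- (c)
  (∀ (k : ℕ) → k ≥ 1 → (ℓ : ℕ) → Prime ℓ → (r : ℕ) → IsValuation ℓ k r →
    (G H : FinAbGroup) → FinAbGroup.IsℓGroup G ℓ → FinAbGroup.IsℓGroup H ℓ →
    (f : Hom G H) → (∀ (h : Carrier H) → ∃ λ (g : Carrier G) → Hom.fun f g ≡ h) →
    (∃ λ (z : Carrier G) → Hom.fun f z ≡ FinAbGroup.ε H × FinAbGroup.IsOrder G z ℓ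
       × (∀ (x : Carrier G) → Hom.fun f x ≡ FinAbGroup.ε H → ∃ λ (m : ℕ) → x ≡ FinAbGroup.mul G m z)) →
    (∃ λ (g : Carrier G) → FinAbGroup.OrdNotDivides G g k × FinAbGroup.OrdDivides H (Hom.fun f g) k)
    ⇔
    (FinAbGroup.quotCard G (ℓ ^ r) ≡ FinAbGroup.quotCard H (ℓ ^ r)))
lemma4p7 =
  (λ k _ G H π → exceptional⇔kernelMeetsMultiples π k) ,
  (λ { .(q * ℓ ^ r) _ G H π ℓ ℓ-prime kernel⊆Sylow r v@(divides q refl , _) →
       let ℓ∤q = valuation⇒¬∣cofactor q r v in
       exceptional⇔exceptional-in-Sylow π ℓ-prime ℓ∤q r kernel⊆Sylow ,
       exceptional-in-Sylow⇔kernel∩Sylow-multiples π ℓ-prime ℓ∤q r }) ,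
  (λ { .(q * ℓ ^ r) _ ℓ ℓ-prime r v@(divides q refl , _) G H _ _ f f-surjective
        (z , fz≡ε , z-order , kernel⊆⟨z⟩) →
       exceptional⇔quotCard≡ f fz≡ε kernel⊆⟨z⟩ ℓ-prime z-order (valuation⇒¬∣cofactor q r v) r f-surjective })
  where open ExceptionalElements
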